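{- Let $\mathcal{I}'$ be a Node Unique Label Cover instance obtained from an instance $\mathcal{I} = (G,\Sigma,k,(\phi_v)_{v \in V(G)}, (\psi_{e,v})_{e \in E(G),v \in e})$ by bypassing a vertex $v$ with $\phi_v \neq \emptyset$. Then the following holds: (1) if $(X,\Psi)$ is a solution to $\mathcal{I}'$, then there exists $\alpha \in \Sigma$ such that $(X,\Psi \cup \{(v,\alpha)\})$ is a solution to $\mathcal{I}$; (2) if $(X,\Psi)$ is a solution to $\mathcal{I}$ that satisfies $v \notin X$, then $(X,\Psi|_{V(G) \setminus \{v\}})$ is a solution to $\mathcal{I}'$.
   Context: A Node Unique Label Cover instance consists of a graph $G$, alphabet $\Sigma$, integer $k$, vertex constraints $\phi_v\subseteq\Sigma$, and for each edge $e=uv$ partial permutations $\psi_{e,u}=\psi_{e,v}^{ -1}$ of $\Sigma$. A solution is a pair $(X,\Psi)$ with $X\subseteq V(G)$, $|X|\le k$, $\Psi:V(G)\setminus X\to\Sigma$ with $\Psi(u)\in\phi_u$ for all $u\notin X$ and $(\Psi(u),\Psi(w))\in\psi_{uw,u}$ for all $uw\in E(G\setminus X)$. For partial permutations, $\psi_2\circ\psi_1=\{(\alpha,\gamma):\exists\beta\,(\alpha,\beta)\in\psi_1,(\beta,\gamma)\in\psi_2\}$. Updating an edge $uw$ with a constraint $\psi$ means: if $uw\notin E(G)$, add it with $\psi_{uw,u}=\psi$, $\psi_{uw,w}=\psi^{ -1}$; otherwise replace $\psi_{uw,u}$ by $\psi_{uw,u}\cap\psi$ and $\psi_{uw,w}$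 by $\psi_{uw,w}\cap\psi^{ -1}$. Bypassing a vertex $v$ means: (1) remove $v$ and its incident edges; (2) for each $u\in N_G(v)$ replace $\phi_u$ by $\phi_u\cap\{\beta:\exists_{\alpha\in\phi_v}(\alpha,\beta)\in\psi_{uv,v}\}$; (3) for each pair of distinct $u_1,u_2\in N_G(v)$, update the edge $u_1u_2$ with the constraint $\psi_{vu_2,v}\circ\psi_{vu_1,u_1}$. -}

module Defs where

open import Data.Nat using (ℕ; suc; _≤_)
open import Data.Empty using (⊥)
open import Data.Bool using (Bool; true; false; T; _∨_; _∧_)
open import Data.Fin using (Fin; punchIn)
open import Data.Fin.Subset using (Subset; _∉_; ∣_∣)
open import Data.Product using (Σ; ∃; _×_)
open import Relation.Binary.PropositionalEquality using (_≡_; _≢_)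

-- A Node Unique Label Cover instance on the vertex set Fin n with alphabet A.
--   adj u w      : u and w are adjacent in G
--   φ u a        : a ∈ φ_u
--   ψ u w a b    : (a , b) ∈ ψ_{uw,u}  (a is a label of u, b a label of w)
record NULC (n : ℕ) (A : Set) : Set₁ where
  field
    adj : Fin n → Fin n → Bool
    k   : ℕ
    φ   : Fin n → A → Set
    ψ   : Fin n → Fin n → A → A → Set

record WellFormed {n : ℕ} {A : Set} (I : NULC n A) : Set where
  open NULC I
  field
    adj-sym    : ∀ u w → T (adj u w) → T (adj w u)
    adj-irrefl : ∀ u → T (adj u u) → ⊥
    ψ-inv      : ∀ u w → T (adj u w) → ∀ a b → ψ u w a b → ψ w u b a
    ψ-func     : ∀ u w → T (adj u w) → ∀ a b b′ → ψ u w a b → ψ u w a b′ → b ≡ b′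
    ψ-inj      : ∀ u w → T (adj u w) → ∀ a a′ b → ψ u w a b → ψ u w a′ b → a ≡ a′

-- Solutions: X is the deleted set, Ψ is a labelling (its values on X are irrelevant).
IsSolution : ∀ {n A} → NULC n A → Subset n → (Fin n → A) → Set
IsSolution {n} I X Ψ =
  ∣ X ∣ ≤ k
  × (∀ u → u ∉ X → φ u (Ψ u))
  × (∀ u w → T (adj u w) → u ∉ X → w ∉ X → ψ u w (Ψ u) (Ψ w))
  where open NULC I

-- Bypassing the vertex v of an instance on Fin (suc m); the remaining vertices
-- V(G) ∖ {v} are identified with Fin m via punchIn v.
bypass : ∀ {m A} → NULC (suc m) A → Fin (suc m) → NULC m A
bypass {m} {A} I v = record { adj = adj′ ; k = k ; φ = φ′ ; ψ = ψ′ }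
  where
    open NULC I
    ι : Fin m → Fin (suc m)
    ι = punchIn v
    open import Data.Fin using (_≟_)
    open import Relation.Nullary.Decidable using (⌊_⌋)
    open import Data.Bool using (not)
    adj′ : Fin m → Fin m → Bool
    adj′ u₁ u₂ = adj (ι u₁) (ι u₂) ∨ (adj v (ι u₁) ∧ adj v (ι u₂) ∧ not ⌊ u₁ ≟ u₂ ⌋)
    φ′ : Fin m → A → Set
    φ′ u β = φ (ι u) β × (T (adj v (ι u)) → ∃ λ α → φ v α × ψ v (ι u) α β)
    ψ′ : Fin m → Fin m → A → A → Set
    ψ′ u₁ u₂ a b =
      (T (adj (ι u₁) (ι u₂)) → ψ (ι u₁) (ι u₂) a b)
      × (T (adj v (ι u₁)) → T (adj v (ι u₂)) → u₁ ≢ u₂ →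
           ∃ λ β → ψ (ι u₁) v a β × ψ v (ι u₂) β b)

-- Deleting v is harmless for part (2): every new constraint of the bypassed instance is
-- witnessed by the old label of v.  For part (1), v must be given a label α back.  If v has
-- no surviving neighbour, any α ∈ φ_v will do.  Otherwise the constraint φ′ on one surviving
-- neighbour u₀ provides α, and the composed constraint ψ_{vu,v} ∘ ψ_{vu₀,u₀} on each further
-- surviving neighbour u forces the intermediate label to be the unique ψ_{u₀v,u₀}-image of
-- Ψ(u₀), i.e. α again; so α is compatible with every neighbour at once.
module Submission where

open import Defs
open import Data.Nat using (ℕ; suc; _≤_; s≤s)
open import Data.Nat.Properties using (≤-refl; ≤-trans; n≤1+n)
open import Data.Bool using (true; false; T)
open import Data.Bool.Properties using (T?; T-∨; T-∧)
open import Data.Empty using (⊥-elim)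
open import Data.Fin using (Fin; punchIn; punchOut; _≟_) renaming (zero to fzero; suc to fsuc)
open import Data.Fin.Properties using (punchInᵢ≢i; punchIn-punchOut; punchOut-punchIn; any?)
open import Data.Fin.Subset using (Subset; _∉_; ∣_∣)
open import Data.Fin.Subset.Properties using (_∈?_)
open import Data.Vec using (Vec; _∷_; insertAt; removeAt; lookup)
open import Data.Vec.Properties using (insertAt-punchIn; removeAt-punchOut; []=⇒lookup; lookup⇒[]=)
import Data.Vec.Functional as Fun
import Data.Vec.Functional.Properties as Fun
open import Data.Product using (∃; _×_; _,_; proj₁)
open import Data.Sum using (inj₁; inj₂)
open import Function using (_∘_; Equivalence)
open import Relation.Binary.PropositionalEquality
open import Relation.Nullary using (yes; no; ¬?)
open import Relation.Nullary.Decidable using (fromWitnessFalse; _×-dec_)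

open Equivalence using (from)

∣insertAt-false∣ : ∀ {n} (X : Subset n) (i : Fin (suc n)) → ∣ insertAt X i false ∣ ≡ ∣ X ∣
∣insertAt-false∣ X            fzero    = refl
∣insertAt-false∣ (true ∷ X)  (fsuc i) = cong suc (∣insertAt-false∣ X i)
∣insertAt-false∣ (false ∷ X) (fsuc i) = ∣insertAt-false∣ X i

∣removeAt∣≤ : ∀ {n} (X : Subset (suc n)) (i : Fin (suc n)) → ∣ removeAt X i ∣ ≤ ∣ X ∣
∣removeAt∣≤ (true ∷ X)      fzero    = n≤1+n _
∣removeAt∣≤ (false ∷ X)     fzero    = ≤-refl
∣removeAt∣≤ (true ∷ y ∷ X)  (fsuc i) = s≤s (∣removeAt∣≤ (y ∷ X) i)
∣removeAt∣≤ (false ∷ y ∷ X) (fsuc i) = ∣removeAt∣≤ (y ∷ X) i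

removeAt-punchIn : ∀ {n} {B : Set} (xs : Vec B (suc n)) (i : Fin (suc n)) (j : Fin n) →
  lookup (removeAt xs i) j ≡ lookup xs (punchIn i j)
removeAt-punchIn xs i j =
  subst (λ j′ → lookup (removeAt xs i) j′ ≡ lookup xs (punchIn i j))
        (punchOut-punchIn i)
        (removeAt-punchOut xs (punchInᵢ≢i i j ∘ sym))

∉-lookup : ∀ {n n′} {X : Subset n} {Y : Subset n′} {i j} →
  lookup Y j ≡ lookup X i → i ∉ X → j ∉ Y
∉-lookup {X = X} {i = i} eq i∉X j∈Y = i∉X (lookup⇒[]= i X (trans (sym eq) ([]=⇒lookup j∈Y)))

∉-insertAt-false : ∀ {n} (X : Subset n) (i : Fin (suc n)) (j : Fin n) →
  punchIn i j ∉ insertAt X i false → j ∉ X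
∉-insertAt-false X i j = ∉-lookup (sym (insertAt-punchIn X i false j))

∉-removeAt : ∀ {n} (X : Subset (suc n)) (i : Fin (suc n)) (j : Fin n) →
  j ∉ removeAt X i → punchIn i j ∉ X
∉-removeAt X i j = ∉-lookup (sym (removeAt-punchIn X i j))

data PunchInView {m} (v : Fin (suc m)) : Fin (suc m) → Set where
  at-v       : PunchInView v v
  at-punchIn : (u : Fin m) → PunchInView v (punchIn v u)

punchInView : ∀ {m} (v w : Fin (suc m)) → PunchInView v w
punchInView v w with v ≟ w
... | yes refl = at-v
... | no v≢w   = subst (PunchInView v) (punchIn-punchOut v≢w) (at-punchIn (punchOut v≢w))

module Bypass {A : Set} {m : ℕ} (I : NULC (suc m) A) (v : Fin (suc m)) where
  open NULC I

  private
    ι : Fin m → Fin (suc m)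
    ι = punchIn v

  module I′ = NULC (bypass I v)

  bypass-edge : ∀ {u₁ u₂} → T (adj v (ι u₁)) → T (adj v (ι u₂)) → u₁ ≢ u₂ → T (I′.adj u₁ u₂)
  bypass-edge {u₁} {u₂} a₁ a₂ u₁≢u₂ =
    from T-∨ (inj₂ (from T-∧ (a₁ , from T-∧ (a₂ , fromWitnessFalse {a? = u₁ ≟ u₂} u₁≢u₂))))

  kept-edge : ∀ {u₁ u₂} → T (adj (ι u₁) (ι u₂)) → T (I′.adj u₁ u₂)
  kept-edge a = from T-∨ (inj₁ a)

  AdmissibleLabel : Subset m → (Fin m → A) → A → Set
  AdmissibleLabel X Ψ α = φ v α × (∀ u → T (adj v (ι u)) → u ∉ X → ψ v (ι u) α (Ψ u))

  module _ (wf : WellFormed I) where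
    open WellFormed wf

    restrict-solution : (X : Subset (suc m)) (Ψ : Fin (suc m) → A) →
      IsSolution I X Ψ → v ∉ X → IsSolution (bypass I v) (removeAt X v) (Ψ ∘ ι)
    restrict-solution X Ψ (|X|≤k , φ-ok , ψ-ok) v∉X = ≤-trans (∣removeAt∣≤ X v) |X|≤k , φ′-ok , ψ′-ok
      where
        kept : ∀ u → u ∉ removeAt X v → ι u ∉ X
        kept = ∉-removeAt X v
        φ′-ok : ∀ u → u ∉ removeAt X v → I′.φ u (Ψ (ι u))
        φ′-ok u u∉ = φ-ok (ι u) (kept u u∉) , λ a → Ψ v , φ-ok v v∉X , ψ-ok v (ι u) a v∉X (kept u u∉)
        ψ′-ok : ∀ u₁ u₂ → T (I′.adj u₁ u₂) → u₁ ∉ removeAt X v → u₂ ∉ removeAt X v →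
                I′.ψ u₁ u₂ (Ψ (ι u₁)) (Ψ (ι u₂))
        ψ′-ok u₁ u₂ _ u₁∉ u₂∉ =
          (λ a → ψ-ok (ι u₁) (ι u₂) a (kept u₁ u₁∉) (kept u₂ u₂∉)) ,
          λ a₁ a₂ _ → Ψ v , ψ-ok (ι u₁) v (adj-sym v (ι u₁) a₁) (kept u₁ u₁∉) v∉X ,
                            ψ-ok v (ι u₂) a₂ v∉X (kept u₂ u₂∉)

    admissibleLabel : (∃ λ α → φ v α) → (X : Subset m) (Ψ : Fin m → A) →
      IsSolution (bypass I v) X Ψ → ∃ (AdmissibleLabel X Ψ)
    admissibleLabel (α₀ , φα₀) X Ψ (_ , φ′-ok , ψ′-ok)
      with any? (λ u → T? (adj v (ι u)) ×-dec ¬? (u ∈? X))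
    ... | no no-live = α₀ , φα₀ , λ u a u∉X → ⊥-elim (no-live (u , a , u∉X))
    ... | yes (u₀ , a₀ , u₀∉X) with φ′-ok u₀ u₀∉X
    ...   | _ , from-v with from-v a₀
    ...     | α , φα , ψα = α , φα , compatible
      where
        compatible : ∀ u → T (adj v (ι u)) → u ∉ X → ψ v (ι u) α (Ψ u)
        compatible u a u∉X with u₀ ≟ u
        ... | yes refl = ψα
        ... | no u₀≢u with ψ′-ok u₀ u (bypass-edge a₀ a u₀≢u) u₀∉X u∉X
        ...   | _ , via-v with via-v a₀ a u₀≢u
        ...     | β , ψu₀β , ψβu = subst (λ γ → ψ v (ι u) γ (Ψ u)) β≡α ψβu
          where
            β≡α : β ≡ α
            β≡α = ψ-func (ι u₀) v (adj-sym v (ι u₀) a₀) (Ψ u₀) β α ψu₀β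
                         (ψ-inv v (ι u₀) a₀ α (Ψ u₀) ψα)

    extend-admissible : (X : Subset m) (Ψ : Fin m → A) (α : A) →
      IsSolution (bypass I v) X Ψ → AdmissibleLabel X Ψ α →
      IsSolution I (insertAt X v false) (Fun.insertAt Ψ v α)
    extend-admissible X Ψ α (|X|≤k , φ′-ok , ψ′-ok) (φα , ψα) =
      subst (_≤ k) (sym (∣insertAt-false∣ X v)) |X|≤k , φ-ok , ψ-ok
      where
        Ψ₀ : Fin (suc m) → A
        Ψ₀ = Fun.insertAt Ψ v α
        X₀ : Subset (suc m)
        X₀ = insertAt X v false
        Ψ₀v≡α : Ψ₀ v ≡ α
        Ψ₀v≡α = Fun.insertAt-lookup Ψ v α
        Ψ₀ι≡Ψ : ∀ u → Ψ₀ (ι u) ≡ Ψ u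
        Ψ₀ι≡Ψ = Fun.insertAt-punchIn Ψ v α
        kept : ∀ u → ι u ∉ X₀ → u ∉ X
        kept = ∉-insertAt-false X v
        φ-ok : ∀ w → w ∉ X₀ → φ w (Ψ₀ w)
        φ-ok w w∉ with punchInView v w
        ... | at-v rewrite Ψ₀v≡α = φα
        ... | at-punchIn u rewrite Ψ₀ι≡Ψ u = proj₁ (φ′-ok u (kept u w∉))
        ψ-ok : ∀ w₁ w₂ → T (adj w₁ w₂) → w₁ ∉ X₀ → w₂ ∉ X₀ → ψ w₁ w₂ (Ψ₀ w₁) (Ψ₀ w₂)
        ψ-ok w₁ w₂ a w₁∉ w₂∉ with punchInView v w₁ | punchInView v w₂
        ... | at-v | at-v = ⊥-elim (adj-irrefl v a)
        ... | at-v | at-punchIn u rewrite Ψ₀v≡α | Ψ₀ι≡Ψ u = ψα u a (kept u w₂∉)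
        ... | at-punchIn u | at-v rewrite Ψ₀v≡α | Ψ₀ι≡Ψ u =
              ψ-inv v (ι u) (adj-sym (ι u) v a) α (Ψ u) (ψα u (adj-sym (ι u) v a) (kept u w₁∉))
        ... | at-punchIn u₁ | at-punchIn u₂ rewrite Ψ₀ι≡Ψ u₁ | Ψ₀ι≡Ψ u₂ =
              proj₁ (ψ′-ok u₁ u₂ (kept-edge a) (kept u₁ w₁∉) (kept u₂ w₂∉)) a

    extend-solution : (∃ λ α → φ v α) → (X : Subset m) (Ψ : Fin m → A) →
      IsSolution (bypass I v) X Ψ →
      ∃ λ α → ∃ λ (Ψ₀ : Fin (suc m) → A) →
        Ψ₀ v ≡ α × (∀ u → Ψ₀ (ι u) ≡ Ψ u) × IsSolution I (insertAt X v false) Ψ₀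
    extend-solution φv≠∅ X Ψ sol with admissibleLabel φv≠∅ X Ψ sol
    ... | α , admissible =
      α , Fun.insertAt Ψ v α , Fun.insertAt-lookup Ψ v α , Fun.insertAt-punchIn Ψ v α ,
      extend-admissible X Ψ α sol admissible

lemma13 : {A : Set} {m : ℕ} (I : NULC (suc m) A) → WellFormed I →
    (v : Fin (suc m)) → (∃ λ α → NULC.φ I v α) →
    ((X : Subset m) (Ψ : Fin m → A) → IsSolution (bypass I v) X Ψ →
       ∃ λ α → ∃ λ (Ψ₀ : Fin (suc m) → A) →
         Ψ₀ v ≡ α × (∀ u → Ψ₀ (punchIn v u) ≡ Ψ u)
         × IsSolution I (insertAt X v false) Ψ₀)
    × ((X : Subset (suc m)) (Ψ : Fin (suc m) → A) → IsSolution I X Ψ → v ∉ X →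
       IsSolution (bypass I v) (removeAt X v) (Ψ ∘ punchIn v))
lemma13 I wf v φv≠∅ = extend-solution wf φv≠∅ , restrict-solution wf
  where open Bypass I v
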